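{- Let $(L;\leq,\cdot,\rightarrow,0,1)$ be an involutive CI-lattice, with $a':=a\rightarrow 0$, which satisfies for all $a,b,c\in L$: (cw1) $a\cdot b=(a\rightarrow b')'$; (cw2) if $a\leq b'$ then $a'\rightarrow b=b'\rightarrow a$ and $a\leq a'\rightarrow b$; (cw3) if $a\leq b'$ and $a\leq c'$, then $a'\rightarrow b\leq c'$ implies $a'\rightarrow c\leq b'$; (cw4) if $b'\leq c$ and $a'\leq b\cdot c$ then $a\cdot(b\cdot c)=(a\cdot b)\cdot c$. Define the partial operation $\oplus$ by $a\oplus b=a'\rightarrow b$ for all $a,b\in L$ with $a\leq b'$ (undefined otherwise). Then $(L;\oplus,0,1)$ is a lattice effect algebra in which the orthosupplement of each $a$ is $a'$, and its Sasaki arrow coincides with $\rightarrow$, i.e. $a'\oplus(a\wedge b)=a\rightarrow b$ for all $a,b\in L$ (where $\wedge$ is the meet of $(L,\leq)$).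
   Context: A CI-lattice is a system $(L;\leq,\cdot,\rightarrow,0,1)$ where $(L;\leq,0,1)$ is a bounded lattice and $\cdot,\rightarrow$ are binary operations with $1\cdot a=a\cdot 1=a$ and $a\cdot c\leq b$ iff $c\leq a\rightarrow b$, for all $a,b,c$. It is involutive if, setting $a':=a\rightarrow 0$, $(L;\leq,',0,1)$ is a bounded involutive lattice, i.e. $a''=a$ and $a\leq b\Rightarrow b'\leq a'$. An effect algebra is a structure $(E;\oplus,0,1)$ with $\oplus$ a partial binary operation such that for all $a,b,c$: (E1) if $a\oplus b$ is defined then $b\oplus a$ is defined and equal to it; (E2) if $b\oplus c$ and $a\oplus(b\oplus c)$ are defined then $a\oplus b$ and $(a\oplus b)\oplus c$ are defined and $a\oplus(b\oplus c)=(a\oplus b)\oplus c$; (E3) for every $a$ there is a unique $a'$ (the orthosupplement) with $a\oplus a'=1$; (E4) if $a\oplus 1$ is defined then $a=0$. The relation $a\leq b$ iff $a\oplus c=b$ for some $c$ is a partial order; a lattice effect algebra is an effect algebra for which this order is a lattice. Its Sasaki arrow is $a\rightarrow_s b:=a'\oplus(a\wedge b)$. -}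

module Defs where

open import Level using (Level; _⊔_) renaming (suc to lsuc)
open import Data.Product using (Σ; ∃; _×_; _,_)
open import Relation.Binary.PropositionalEquality using (_≡_)
open import Relation.Binary.Lattice.Structures using (IsBoundedLattice)

record CILattice (c ℓ : Level) : Set (lsuc (c ⊔ ℓ)) where
  infixl 7 _·_
  infixr 5 _⇒_
  infixr 7 _∧_
  infixr 6 _∨_
  infix  4 _≤_
  field
    Carrier : Set c
    _≤_     : Carrier → Carrier → Set ℓ
    _∧_     : Carrier → Carrier → Carrier
    _∨_     : Carrier → Carrier → Carrier
    _·_     : Carrier → Carrier → Carrier
    _⇒_     : Carrier → Carrier → Carrier
    0#      : Carrier
    1#      : Carrier
    isBoundedLattice : IsBoundedLattice _≡_ _≤_ _∨_ _∧_ 1# 0#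
    ·-identityˡ : ∀ a → 1# · a ≡ a
    ·-identityʳ : ∀ a → a · 1# ≡ a
    residuated  : ∀ a b c → (a · c ≤ b → c ≤ a ⇒ b) × (c ≤ a ⇒ b → a · c ≤ b)

  _′ : Carrier → Carrier
  a ′ = a ⇒ 0#
  infix 8 _′

IsInvolutive : ∀ {c ℓ} → CILattice c ℓ → Set (c ⊔ ℓ)
IsInvolutive L = (∀ a → a ′ ′ ≡ a) × (∀ a b → a ≤ b → b ′ ≤ a ′)
  where open CILattice L

CW : ∀ {c ℓ} → CILattice c ℓ → Set (c ⊔ ℓ)
CW L =
    (∀ a b → a · b ≡ (a ⇒ b ′) ′)
  × (∀ a b → a ≤ b ′ → (a ′ ⇒ b ≡ b ′ ⇒ a) × (a ≤ a ′ ⇒ b))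
  × (∀ a b c → a ≤ b ′ → a ≤ c ′ → a ′ ⇒ b ≤ c ′ → a ′ ⇒ c ≤ b ′)
  × (∀ a b c → b ′ ≤ c → a ′ ≤ b · c → a · (b · c) ≡ (a · b) · c)
  where open CILattice L

-- A partial binary operation on E is given by its
-- domain  D : E → E → Set  (D a b means "a ⊕ b is defined") together
-- with a function  _⊕_  whose value matters only on the domain; every
-- axiom below only inspects a ⊕ b under the hypothesis D a b.

module EffectAlgebraDefs {c d : Level} {E : Set c}
         (D : E → E → Set d) (_⊕_ : E → E → E) (0e 1e : E) where

  E1 : Set (c ⊔ d)
  E1 = ∀ a b → D a b → D b a × (b ⊕ a ≡ a ⊕ b)

  E2 : Set (c ⊔ d)
  E2 = ∀ a b c → D b c → D a (b ⊕ c) →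
         Σ (D a b) (λ _ → D (a ⊕ b) c × (a ⊕ (b ⊕ c) ≡ (a ⊕ b) ⊕ c))

  IsOrthosupplement : E → E → Set (c ⊔ d)
  IsOrthosupplement a a' =
    (D a a' × (a ⊕ a' ≡ 1e)) × (∀ y → D a y → a ⊕ y ≡ 1e → y ≡ a')

  E3 : Set (c ⊔ d)
  E3 = ∀ a → ∃ λ a' → IsOrthosupplement a a'

  E4 : Set (c ⊔ d)
  E4 = ∀ a → D a 1e → a ≡ 0e

  IsEffectAlgebra : Set (c ⊔ d)
  IsEffectAlgebra = E1 × E2 × E3 × E4

  _≼_ : E → E → Set (c ⊔ d)
  a ≼ b = ∃ λ x → D a x × (a ⊕ x ≡ b)

  IsMeet : E → E → E → Set (c ⊔ d)
  IsMeet a b m = m ≼ a × m ≼ b × (∀ x → x ≼ a → x ≼ b → x ≼ m)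

  IsJoin : E → E → E → Set (c ⊔ d)
  IsJoin a b j = a ≼ j × b ≼ j × (∀ x → a ≼ x → b ≼ x → j ≼ x)

  IsLatticeEffectAlgebra : Set (c ⊔ d)
  IsLatticeEffectAlgebra =
    IsEffectAlgebra × (∀ a b → ∃ (IsMeet a b)) × (∀ a b → ∃ (IsJoin a b))

module Induced {c ℓ} (L : CILattice c ℓ) where
  open CILattice L

  Dom : Carrier → Carrier → Set ℓ
  Dom a b = a ≤ b ′

  infixl 6 _⊕_
  _⊕_ : Carrier → Carrier → Carrier
  a ⊕ b = a ′ ⇒ b

  open EffectAlgebraDefs Dom _⊕_ 0# 1# public

module Submission where

-- With a ⊕ b := a' → b (defined iff a ≤ b'), the proof runs as follows.
--   * Residuation alone gives the basic calculus of → and ·: evaluation,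
--     monotonicity, a → a = 1, 1' = 0 and a → (a ∧ b) = a → b.
--   * Involution and (cw1) turn → into ·:  (a → b)' = a · b'.
--   * The effect-algebra axioms: (E1) is (cw2); (E2) is (cw3) for
--     definedness and (cw4), transported along (cw1), for associativity;
--     (E3) holds with orthosupplement a', uniqueness by residuation;
--     (E4) is 1' = 0.
--   * In any partial algebra with (E1) and (E2), associativity also holds
--     "to the right".  Using it, the induced order ≼ coincides with ≤
--     (a ≤ b is witnessed by a ⊕ (b' ⊕ a)' = b), so ≼ is a lattice with
--     the meets and joins of L, and every ≼-meet of a, b equals a ∧ b.
--   * The Sasaki identity a'' → (a ∧ b) = a → b is then a → (a ∧ b) = a → b.

open import Defs
open import Data.Product using (∃; _×_; _,_; proj₁; proj₂)
open import Relation.Binary.PropositionalEquality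
  using (_≡_; sym; trans; cong; subst; module ≡-Reasoning)
open import Relation.Binary.Lattice.Structures using (IsBoundedLattice)

-- This is (E2) read from left to right, obtained by commuting twice.
module RightAssociativity {c d} {E : Set c} (D : E → E → Set d)
         (_⊕_ : E → E → E) (0e 1e : E) where
  open EffectAlgebraDefs D _⊕_ 0e 1e

  ⊕-assocʳ : E1 → E2 → ∀ {a b x} → D a b → D (a ⊕ b) x →
             D b x × D a (b ⊕ x) × (a ⊕ (b ⊕ x) ≡ (a ⊕ b) ⊕ x)
  ⊕-assocʳ e1 e2 {a} {b} {x} dab dab-x = dbx , da-bx , assoc
    where
    dba : D b a
    dba = proj₁ (e1 a b dab)
    ba≡ab : b ⊕ a ≡ a ⊕ b
    ba≡ab = proj₂ (e1 a b dab)
    dx-ab : D x (a ⊕ b)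
    dx-ab = proj₁ (e1 (a ⊕ b) x dab-x)
    xba : D x b × D (x ⊕ b) a × (x ⊕ (b ⊕ a) ≡ (x ⊕ b) ⊕ a)
    xba = e2 x b a dba (subst (D x) (sym ba≡ab) dx-ab)
    dxb-a : D (x ⊕ b) a
    dxb-a = proj₁ (proj₂ xba)
    dbx : D b x
    dbx = proj₁ (e1 x b (proj₁ xba))
    xb≡bx : x ⊕ b ≡ b ⊕ x
    xb≡bx = proj₂ (e1 b x dbx)
    da-bx : D a (b ⊕ x)
    da-bx = subst (D a) xb≡bx (proj₁ (e1 (x ⊕ b) a dxb-a))
    open ≡-Reasoning
    assoc : a ⊕ (b ⊕ x) ≡ (a ⊕ b) ⊕ x
    assoc = begin
      a ⊕ (b ⊕ x)   ≡⟨ sym (proj₂ (e1 a (b ⊕ x) da-bx)) ⟩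
      (b ⊕ x) ⊕ a   ≡⟨ cong (_⊕ a) (sym xb≡bx) ⟩
      (x ⊕ b) ⊕ a   ≡⟨ sym (proj₂ (proj₂ xba)) ⟩
      x ⊕ (b ⊕ a)   ≡⟨ cong (x ⊕_) ba≡ab ⟩
      x ⊕ (a ⊕ b)   ≡⟨ proj₂ (e1 (a ⊕ b) x dab-x) ⟩
      (a ⊕ b) ⊕ x   ∎

module ResiduationFacts {c ℓ} (L : CILattice c ℓ) where
  open CILattice L
  open IsBoundedLattice isBoundedLattice public
    using (maximum; minimum; x∧y≤x; x∧y≤y; ∧-greatest; x≤x∨y; y≤x∨y; ∨-least)
    renaming (refl to ≤-refl; reflexive to ≤-reflexive; trans to ≤-trans;
              antisym to ≤-antisym)

  residuate : ∀ {a b x} → a · x ≤ b → x ≤ a ⇒ b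
  residuate {a} {b} {x} = proj₁ (residuated a b x)

  unresiduate : ∀ {a b x} → x ≤ a ⇒ b → a · x ≤ b
  unresiduate {a} {b} {x} = proj₂ (residuated a b x)

  evaluation : ∀ {a b} → a · (a ⇒ b) ≤ b
  evaluation = unresiduate ≤-refl

  ⇒-monoʳ : ∀ {a b x} → b ≤ x → a ⇒ b ≤ a ⇒ x
  ⇒-monoʳ b≤x = residuate (≤-trans evaluation b≤x)

  ⇒-self : ∀ a → a ⇒ a ≡ 1#
  ⇒-self a = ≤-antisym (maximum _) (residuate (≤-reflexive (·-identityʳ a)))

  -- a · x ≤ a, since x ≤ 1 = a → a
  ·-decreasingˡ : ∀ {a x} → a · x ≤ a
  ·-decreasingˡ {a} = unresiduate (≤-trans (maximum _) (≤-reflexive (sym (⇒-self a))))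

  1′≡0 : 1# ′ ≡ 0#
  1′≡0 = ≤-antisym (subst (_≤ 0#) (·-identityˡ (1# ′)) evaluation) (minimum _)

  -- a → (a ∧ b) = a → b: the residuum only sees b below a
  ⇒-absorbs-∧ : ∀ a b → a ⇒ (a ∧ b) ≡ a ⇒ b
  ⇒-absorbs-∧ a b =
    ≤-antisym (⇒-monoʳ (x∧y≤y a b))
            (residuate (∧-greatest ·-decreasingˡ evaluation))

module InvolutionFacts {c ℓ} (L : CILattice c ℓ) (I : IsInvolutive L) where
  open CILattice L

  ′′ : ∀ a → a ′ ′ ≡ a
  ′′ = proj₁ I

  ′-antitone : ∀ {a b} → a ≤ b → b ′ ≤ a ′
  ′-antitone {a} {b} = proj₂ I a b

  ′-swap : ∀ {a b} → a ≤ b ′ → b ≤ a ′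
  ′-swap {a} {b} a≤b′ = subst (_≤ a ′) (′′ b) (′-antitone a≤b′)

module InducedEffectAlgebra {c ℓ} (L : CILattice c ℓ)
         (I : IsInvolutive L) (C : CW L) where
  open CILattice L
  open Induced L
  open ResiduationFacts L
  open InvolutionFacts L I
  open RightAssociativity Dom _⊕_ 0# 1#

  cw1 : ∀ a b → a · b ≡ (a ⇒ b ′) ′
  cw1 = proj₁ C

  cw2 : ∀ a b → a ≤ b ′ → (a ′ ⇒ b ≡ b ′ ⇒ a) × (a ≤ a ′ ⇒ b)
  cw2 = proj₁ (proj₂ C)

  cw3 : ∀ a b x → a ≤ b ′ → a ≤ x ′ → a ′ ⇒ b ≤ x ′ → a ′ ⇒ x ≤ b ′
  cw3 = proj₁ (proj₂ (proj₂ C))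

  cw4 : ∀ a b x → b ′ ≤ x → a ′ ≤ b · x → a · (b · x) ≡ (a · b) · x
  cw4 = proj₂ (proj₂ (proj₂ C))

  ′-⇒ : ∀ a b → (a ⇒ b) ′ ≡ a · b ′
  ′-⇒ a b = sym (trans (cw1 a (b ′)) (cong (λ x → (a ⇒ x) ′) (′′ b)))

  ⇒-via-· : ∀ a b → a ⇒ b ≡ (a · b ′) ′
  ⇒-via-· a b = trans (sym (′′ (a ⇒ b))) (cong _′ (′-⇒ a b))

  ⊕-upperˡ : ∀ {a b} → Dom a b → a ≤ a ⊕ b
  ⊕-upperˡ {a} {b} dab = proj₂ (cw2 a b dab)

  e1 : E1
  e1 a b dab = ′-swap dab , sym (proj₁ (cw2 a b dab))

  e2 : E2
  e2 a b x dbx da-bx = dab , dab-x , assoc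
    where
    dab : a ≤ b ′
    dab = ≤-trans da-bx (′-antitone (⊕-upperˡ dbx))
    dab-x : a ′ ⇒ b ≤ x ′
    dab-x = subst (_≤ x ′) (proj₂ (e1 a b dab))
              (cw3 b x a dbx (′-swap dab) (′-swap da-bx))
    ·-assoc : a ′ · (b ′ · x ′) ≡ (a ′ · b ′) · x ′
    ·-assoc = cw4 (a ′) (b ′) (x ′)
      (subst (_≤ x ′) (sym (′′ b)) dbx)
      (subst (_≤ b ′ · x ′) (sym (′′ a)) (subst (a ≤_) (′-⇒ (b ′) x) da-bx))
    open ≡-Reasoning
    assoc : a ′ ⇒ (b ′ ⇒ x) ≡ (a ′ ⇒ b) ′ ⇒ x
    assoc = begin
      a ′ ⇒ (b ′ ⇒ x)             ≡⟨ ⇒-via-· (a ′) (b ′ ⇒ x) ⟩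
      (a ′ · (b ′ ⇒ x) ′) ′        ≡⟨ cong (λ y → (a ′ · y) ′) (′-⇒ (b ′) x) ⟩
      (a ′ · (b ′ · x ′)) ′        ≡⟨ cong _′ ·-assoc ⟩
      ((a ′ · b ′) · x ′) ′        ≡⟨ cong (λ y → (y · x ′) ′) (sym (′-⇒ (a ′) b)) ⟩
      ((a ′ ⇒ b) ′ · x ′) ′        ≡⟨ sym (⇒-via-· ((a ′ ⇒ b) ′) x) ⟩
      (a ′ ⇒ b) ′ ⇒ x             ∎

  -- (E3): a' is the unique y with a ⊕ y = 1; from 1 ≤ a' → y we get a' ≤ y
  orthosupplement : ∀ a → IsOrthosupplement a (a ′)
  orthosupplement a = (≤-reflexive (sym (′′ a)) , ⇒-self (a ′)) , unique
    where
    unique : ∀ y → Dom a y → a ⊕ y ≡ 1# → y ≡ a ′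
    unique y day a⊕y≡1 = ≤-antisym (′-swap day)
      (subst (_≤ y) (·-identityʳ (a ′)) (unresiduate (≤-reflexive (sym a⊕y≡1))))

  e4 : E4
  e4 a da1 = ≤-antisym (subst (a ≤_) 1′≡0 da1) (minimum _)

  isEffectAlgebra : IsEffectAlgebra
  isEffectAlgebra = e1 , e2 , (λ a → a ′ , orthosupplement a) , e4

  ≼⇒≤ : ∀ {a b} → a ≼ b → a ≤ b
  ≼⇒≤ {a} (x , dax , a⊕x≡b) = subst (a ≤_) a⊕x≡b (⊕-upperˡ dax)

  -- a ≤ b: with y = b' ⊕ a, the element a ⊕ y' is an orthosupplement
  -- of b' (by right associativity), hence equals b'' = b
  ≤⇒≼ : ∀ {a b} → a ≤ b → a ≼ b
  ≤⇒≼ {a} {b} a≤b = y ′ , proj₁ assoc , a⊕y′≡b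
    where
    y : Carrier
    y = b ′ ⊕ a
    assoc : Dom a (y ′) × Dom (b ′) (a ⊕ y ′) × (b ′ ⊕ (a ⊕ y ′) ≡ (b ′ ⊕ a) ⊕ y ′)
    assoc = ⊕-assocʳ e1 e2 {b ′} {a} {y ′} (′-antitone a≤b)
              (proj₁ (proj₁ (orthosupplement y)))
    b′⊕[a⊕y′]≡1 : b ′ ⊕ (a ⊕ y ′) ≡ 1#
    b′⊕[a⊕y′]≡1 = trans (proj₂ (proj₂ assoc)) (proj₂ (proj₁ (orthosupplement y)))
    a⊕y′≡b : a ⊕ y ′ ≡ b
    a⊕y′≡b = trans (proj₂ (orthosupplement (b ′)) (a ⊕ y ′)
                     (proj₁ (proj₂ assoc)) b′⊕[a⊕y′]≡1)
                   (′′ b)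

  meets : ∀ a b → ∃ (IsMeet a b)
  meets a b = a ∧ b , ≤⇒≼ (x∧y≤x a b) , ≤⇒≼ (x∧y≤y a b) ,
    λ x x≼a x≼b → ≤⇒≼ (∧-greatest (≼⇒≤ x≼a) (≼⇒≤ x≼b))

  joins : ∀ a b → ∃ (IsJoin a b)
  joins a b = a ∨ b , ≤⇒≼ (x≤x∨y a b) , ≤⇒≼ (y≤x∨y a b) ,
    λ x a≼x b≼x → ≤⇒≼ (∨-least (≼⇒≤ a≼x) (≼⇒≤ b≼x))

  isLatticeEffectAlgebra : IsLatticeEffectAlgebra
  isLatticeEffectAlgebra = isEffectAlgebra , meets , joins

  -- since ≼ and ≤ coincide, any ≼-meet of a and b is a ∧ b
  meet≡∧ : ∀ {a b m} → IsMeet a b m → m ≡ a ∧ b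
  meet≡∧ {a} {b} (m≼a , m≼b , greatest) =
    ≤-antisym (∧-greatest (≼⇒≤ m≼a) (≼⇒≤ m≼b))
            (≼⇒≤ (greatest (a ∧ b) (≤⇒≼ (x∧y≤x a b)) (≤⇒≼ (x∧y≤y a b))))

  sasaki : ∀ a b → Dom (a ′) (a ∧ b) × (a ′ ⊕ (a ∧ b) ≡ a ⇒ b)
  sasaki a b = ′-antitone (x∧y≤x a b) ,
               trans (cong (_⇒ (a ∧ b)) (′′ a)) (⇒-absorbs-∧ a b)

  sasakiAtMeet : ∀ a b m → IsMeet a b m → Dom (a ′) m × (a ′ ⊕ m ≡ a ⇒ b)
  sasakiAtMeet a b m isMeet =
    subst (λ z → Dom (a ′) z × (a ′ ⊕ z ≡ a ⇒ b)) (sym (meet≡∧ isMeet)) (sasaki a b)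

mainTheorem4 : ∀ {c ℓ} (L : CILattice c ℓ) → IsInvolutive L → CW L →
    let open CILattice L
        open Induced L
    in IsLatticeEffectAlgebra
       × (∀ a → IsOrthosupplement a (a ′))
       × (∀ a b m → IsMeet a b m → Dom (a ′) m × (a ′ ⊕ m ≡ a ⇒ b))
       × (∀ a b → Dom (a ′) (a ∧ b) × (a ′ ⊕ (a ∧ b) ≡ a ⇒ b))
mainTheorem4 L I C =
  isLatticeEffectAlgebra , orthosupplement , sasakiAtMeet , sasaki
  where open InducedEffectAlgebra L I C
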